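{- Let $\mathbb{Z}_2^n$ denote the group $(\{0,1\}^n, +)$ with componentwise addition modulo 2, and let $F_n = \mathbb{Z}_2^n \setminus \{0\}$. For $n = 3$ and for $n = 4$, there is no permutation $(v_1, \ldots, v_{2^n-1})$ of $F_n$ such that $v_{i-1} + v_i + v_{i+1} = 0$ for every $i \in \{2, 4, \ldots, 2^n - 2\}$. -}

module Defs where

open import Data.Bool using (Bool; false; true; _xor_)
open import Data.Nat using (ℕ; suc; _+_; _*_; _∸_; _^_)
open import Data.Fin using (Fin; toℕ)
open import Data.Vec using (Vec; zipWith; replicate)
open import Data.Product using (_×_; Σ; ∃; _,_)
open import Relation.Binary.PropositionalEquality using (_≡_; _≢_)
open import Function.Definitions using (Injective)

Z2^ : ℕ → Set
Z2^ n = Vec Bool n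

_⊕_ : ∀ {n} → Z2^ n → Z2^ n → Z2^ n
_⊕_ = zipWith _xor_

𝟎 : ∀ {n} → Z2^ n
𝟎 = replicate _ false

InF : ∀ {n} → Z2^ n → Set
InF v = v ≢ 𝟎

-- A permutation (v₀, …, v_{2ⁿ-2}) of Fₙ (0-based indexing): a sequence
-- indexed by Fin (2ⁿ − 1) that is injective, takes values in Fₙ, and
-- hits every element of Fₙ.
IsPermutationOfF : (n : ℕ) → (Fin (2 ^ n ∸ 1) → Z2^ n) → Set
IsPermutationOfF n v =
  Injective _≡_ _≡_ v
  × (∀ i → InF (v i))
  × (∀ (w : Z2^ n) → InF w → ∃ λ i → v i ≡ w)

-- The condition v_{i-1} + v_i + v_{i+1} = 0 for every even i (1-based)
-- with 2 ≤ i ≤ 2ⁿ − 2.  In 0-based indexing, 1-based i = 2(k+1) corresponds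
-- to the triple of 0-based positions 2k, 2k+1, 2k+2; these lie in range
-- exactly for the admissible i.
TripleCondition : (n : ℕ) → (Fin (2 ^ n ∸ 1) → Z2^ n) → Set
TripleCondition n v =
  ∀ (k : ℕ) (a b c : Fin (2 ^ n ∸ 1)) →
  toℕ a ≡ 2 * k → toℕ b ≡ 2 * k + 1 → toℕ c ≡ 2 * k + 2 →
  (v a ⊕ v b) ⊕ v c ≡ 𝟎

-- Write the sequence as a₀, b₀, a₁, b₁, …, a_m with m = 2ⁿ⁻¹ − 1, so the condition says
-- b_k = a_k + a_{k+1}.  Injective linear maps of Z₂ⁿ preserve this, and two transvections
-- x ↦ x + (f·x)(u + v) carry any two distinct nonzero vectors a₀, a₁ to e₁, e₂.  It thus
-- suffices to rule out sequences beginning e₁, e₁ + e₂, e₂.  That is a finite search, in which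
-- each a_{k+1} must make both a_{k+1} and b_k new and nonzero; for n = 3 and n = 4 it is
-- exhausted by evaluation.
module Submission where

open import Defs

open import Algebra.Bundles using (CommutativeRing)
import Algebra.Properties.CommutativeSemigroup as CommutativeSemigroupProperties
open import Data.Bool using (Bool; true; false; _∧_; _xor_; if_then_else_; T)
open import Data.Bool.ListAction using (any)
open import Data.Bool.Properties
  using (xor-assoc; xor-comm; xor-identityˡ; xor-identityʳ; xor-same; ∧-zeroʳ; ∧-distribˡ-xor;
         xor-∧-commutativeRing)
  renaming (_≟_ to _≟ᵇ_)
open import Data.Empty using (⊥-elim)
open import Data.Fin using (Fin; toℕ; fromℕ<)
open import Data.Fin.Properties using (toℕ-fromℕ<)
open import Data.List using (List; []; _∷_; map; _++_)
open import Data.List.Membership.Propositional using (_∈_; _∉_; lose)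
open import Data.List.Membership.Propositional.Properties using (∈-map⁺; ∈-++⁺ˡ; ∈-++⁺ʳ)
import Data.List.Membership.DecPropositional as DecMembership
open import Data.List.Relation.Unary.Any using (here; there)
open import Data.List.Relation.Unary.Any.Properties using (any⁺)
open import Data.Nat using (ℕ; zero; suc; _∸_; _^_; _*_; _+_; _<_; _≤_; z≤n; s≤s; _<?_)
open import Data.Nat.Properties
  using (<-trans; <⇒≤; <⇒≢; n<1+n; ≤-refl; m<m+n; *-suc; *-monoʳ-≤; +-suc; +-comm;
         module ≤-Reasoning)
open import Data.Product using (Σ; ∃; _×_; _,_)
open import Data.Vec using ([]; _∷_)
open import Data.Vec.Properties using (zipWith-assoc; zipWith-comm; zipWith-identityˡ; zipWith-identityʳ; ≡-dec)
open import Function using (_∘_)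
open import Function.Definitions using (Injective)
open import Relation.Nullary using (¬_; Dec; does; yes; no; contradiction)
open import Relation.Binary.PropositionalEquality

open CommutativeSemigroupProperties (CommutativeRing.+-commutativeSemigroup xor-∧-commutativeRing)
  using () renaming (interchange to xor-interchange)

⊕-self : ∀ {n} (x : Z2^ n) → x ⊕ x ≡ 𝟎
⊕-self []      = refl
⊕-self (b ∷ x) = cong₂ _∷_ (xor-same b) (⊕-self x)

⊕-interchange : ∀ {n} (x y z w : Z2^ n) → (x ⊕ y) ⊕ (z ⊕ w) ≡ (x ⊕ z) ⊕ (y ⊕ w)
⊕-interchange []      []      []      []      = refl
⊕-interchange (a ∷ x) (b ∷ y) (c ∷ z) (d ∷ w) =
  cong₂ _∷_ (xor-interchange a b c d) (⊕-interchange x y z w)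

module _ {n : ℕ} where

  ⊕-assoc : (x y z : Z2^ n) → (x ⊕ y) ⊕ z ≡ x ⊕ (y ⊕ z)
  ⊕-assoc = zipWith-assoc xor-assoc

  ⊕-comm : (x y : Z2^ n) → x ⊕ y ≡ y ⊕ x
  ⊕-comm = zipWith-comm xor-comm

  ⊕-identityˡ : (x : Z2^ n) → 𝟎 ⊕ x ≡ x
  ⊕-identityˡ = zipWith-identityˡ xor-identityˡ

  ⊕-identityʳ : (x : Z2^ n) → x ⊕ 𝟎 ≡ x
  ⊕-identityʳ = zipWith-identityʳ xor-identityʳ

  open ≡-Reasoning

  ⊕-cancelˡ : (x y : Z2^ n) → x ⊕ (x ⊕ y) ≡ y
  ⊕-cancelˡ x y = begin
    x ⊕ (x ⊕ y)  ≡⟨ ⊕-assoc x x y ⟨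
    (x ⊕ x) ⊕ y  ≡⟨ cong (_⊕ y) (⊕-self x) ⟩
    𝟎 ⊕ y        ≡⟨ ⊕-identityˡ y ⟩
    y            ∎

  ⊕-cancelʳ : (x y : Z2^ n) → (x ⊕ y) ⊕ y ≡ x
  ⊕-cancelʳ x y = begin
    (x ⊕ y) ⊕ y  ≡⟨ ⊕-assoc x y y ⟩
    x ⊕ (y ⊕ y)  ≡⟨ cong (x ⊕_) (⊕-self y) ⟩
    x ⊕ 𝟎        ≡⟨ ⊕-identityʳ x ⟩
    x            ∎

  ⊕≡𝟎⇒≡ : {x y : Z2^ n} → x ⊕ y ≡ 𝟎 → x ≡ y
  ⊕≡𝟎⇒≡ {x} {y} x⊕y≡𝟎 = begin
    x            ≡⟨ ⊕-cancelʳ x y ⟨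
    (x ⊕ y) ⊕ y  ≡⟨ cong (_⊕ y) x⊕y≡𝟎 ⟩
    𝟎 ⊕ y        ≡⟨ ⊕-identityˡ y ⟩
    y            ∎

  zero-sum⇒middle : {a b c : Z2^ n} → (a ⊕ b) ⊕ c ≡ 𝟎 → b ≡ a ⊕ c
  zero-sum⇒middle {a} {b} {c} sum≡𝟎 = ⊕≡𝟎⇒≡ (begin
    b ⊕ (a ⊕ c)  ≡⟨ ⊕-assoc b a c ⟨
    (b ⊕ a) ⊕ c  ≡⟨ cong (_⊕ c) (⊕-comm b a) ⟩
    (a ⊕ b) ⊕ c  ≡⟨ sum≡𝟎 ⟩
    𝟎            ∎)

infixr 21 _∙_

_∙_ : ∀ {n} → Bool → Z2^ n → Z2^ n
b ∙ d = if b then d else 𝟎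

∙-distribʳ-xor : ∀ {n} p q (d : Z2^ n) → (p xor q) ∙ d ≡ p ∙ d ⊕ q ∙ d
∙-distribʳ-xor true  true  d = sym (⊕-self d)
∙-distribʳ-xor true  false d = sym (⊕-identityʳ d)
∙-distribʳ-xor false true  d = sym (⊕-identityˡ d)
∙-distribʳ-xor false false d = sym (⊕-identityˡ 𝟎)

infix 19 _·_

_·_ : ∀ {n} → Z2^ n → Z2^ n → Bool
[]      · []      = false
(a ∷ f) · (b ∷ x) = (a ∧ b) xor (f · x)

·-zeroˡ : ∀ {n} (x : Z2^ n) → 𝟎 · x ≡ false
·-zeroˡ []      = refl
·-zeroˡ (_ ∷ x) = ·-zeroˡ x

·-zeroʳ : ∀ {n} (f : Z2^ n) → f · 𝟎 ≡ false
·-zeroʳ []          = refl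
·-zeroʳ (true  ∷ f) = ·-zeroʳ f
·-zeroʳ (false ∷ f) = ·-zeroʳ f

·-distribˡ-⊕ : ∀ {n} (f x y : Z2^ n) → f · (x ⊕ y) ≡ (f · x) xor (f · y)
·-distribˡ-⊕ []      []      []      = refl
·-distribˡ-⊕ (a ∷ f) (b ∷ x) (c ∷ y) = begin
  (a ∧ (b xor c)) xor (f · (x ⊕ y))                ≡⟨ cong₂ _xor_ (∧-distribˡ-xor a b c) (·-distribˡ-⊕ f x y) ⟩
  ((a ∧ b) xor (a ∧ c)) xor ((f · x) xor (f · y))  ≡⟨ xor-interchange (a ∧ b) (a ∧ c) (f · x) (f · y) ⟩
  ((a ∧ b) xor (f · x)) xor ((a ∧ c) xor (f · y))  ∎
  where open ≡-Reasoning

·-∙ : ∀ {n} (f : Z2^ n) b d → f · (b ∙ d) ≡ b ∧ (f · d)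
·-∙ f true  d = refl
·-∙ f false d = ·-zeroʳ f

record LinearInjection (n : ℕ) : Set where
  field
    apply           : Z2^ n → Z2^ n
    apply-⊕         : ∀ x y → apply (x ⊕ y) ≡ apply x ⊕ apply y
    apply-injective : Injective _≡_ _≡_ apply

  apply-𝟎 : apply 𝟎 ≡ 𝟎
  apply-𝟎 = begin
    apply 𝟎              ≡⟨ cong apply (⊕-self 𝟎) ⟨
    apply (𝟎 ⊕ 𝟎)        ≡⟨ apply-⊕ 𝟎 𝟎 ⟩
    apply 𝟎 ⊕ apply 𝟎    ≡⟨ ⊕-self (apply 𝟎) ⟩
    𝟎                    ∎
    where open ≡-Reasoning

  apply-nonzero : ∀ {x} → x ≢ 𝟎 → apply x ≢ 𝟎
  apply-nonzero x≢𝟎 applyx≡𝟎 = x≢𝟎 (apply-injective (trans applyx≡𝟎 (sym apply-𝟎)))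

open LinearInjection

_∘ᴸ_ : ∀ {n} → LinearInjection n → LinearInjection n → LinearInjection n
φ ∘ᴸ ψ = record
  { apply           = apply φ ∘ apply ψ
  ; apply-⊕         = λ x y → trans (cong (apply φ) (apply-⊕ ψ x y)) (apply-⊕ φ _ _)
  ; apply-injective = apply-injective ψ ∘ apply-injective φ
  }

-- f · d ≡ false is what makes the transvection an involution, hence injective.
transvection : ∀ {n} (f d : Z2^ n) → f · d ≡ false → LinearInjection n
transvection {n} f d f·d≡false = record { apply = τ ; apply-⊕ = τ-⊕ ; apply-injective = τ-injective }
  where
  open ≡-Reasoning

  τ : Z2^ n → Z2^ n
  τ x = x ⊕ (f · x) ∙ d

  τ-⊕ : ∀ x y → τ (x ⊕ y) ≡ τ x ⊕ τ y
  τ-⊕ x y = begin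
    (x ⊕ y) ⊕ (f · (x ⊕ y)) ∙ d               ≡⟨ cong (λ b → (x ⊕ y) ⊕ b ∙ d) (·-distribˡ-⊕ f x y) ⟩
    (x ⊕ y) ⊕ ((f · x) xor (f · y)) ∙ d       ≡⟨ cong ((x ⊕ y) ⊕_) (∙-distribʳ-xor (f · x) (f · y) d) ⟩
    (x ⊕ y) ⊕ ((f · x) ∙ d ⊕ (f · y) ∙ d)     ≡⟨ ⊕-interchange x y _ _ ⟩
    τ x ⊕ τ y                                 ∎

  f·τ : ∀ x → f · τ x ≡ f · x
  f·τ x = begin
    f · (x ⊕ (f · x) ∙ d)          ≡⟨ ·-distribˡ-⊕ f x _ ⟩
    (f · x) xor (f · (f · x) ∙ d)  ≡⟨ cong ((f · x) xor_) (·-∙ f (f · x) d) ⟩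
    (f · x) xor ((f · x) ∧ f · d)  ≡⟨ cong (λ b → (f · x) xor ((f · x) ∧ b)) f·d≡false ⟩
    (f · x) xor ((f · x) ∧ false)  ≡⟨ cong ((f · x) xor_) (∧-zeroʳ (f · x)) ⟩
    (f · x) xor false              ≡⟨ xor-identityʳ (f · x) ⟩
    f · x                          ∎

  τ-involutive : ∀ x → τ (τ x) ≡ x
  τ-involutive x = begin
    τ x ⊕ (f · τ x) ∙ d  ≡⟨ cong (λ b → τ x ⊕ b ∙ d) (f·τ x) ⟩
    τ x ⊕ (f · x) ∙ d    ≡⟨ ⊕-cancelʳ x _ ⟩
    x                    ∎

  τ-injective : Injective _≡_ _≡_ τ
  τ-injective {x} {y} τx≡τy = begin
    x          ≡⟨ τ-involutive x ⟨
    τ (τ x)    ≡⟨ cong τ τx≡τy ⟩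
    τ (τ y)    ≡⟨ τ-involutive y ⟩
    y          ∎

transvection-sends : ∀ {n} (f : Z2^ n) {u v} → f · u ≡ true → f · v ≡ true →
  Σ (LinearInjection n) λ τ → apply τ u ≡ v × (∀ {z} → f · z ≡ false → apply τ z ≡ z)
transvection-sends f {u} {v} f·u≡true f·v≡true =
  transvection f (u ⊕ v) f·[u⊕v]≡false , sends , fixes
  where
  f·[u⊕v]≡false : f · (u ⊕ v) ≡ false
  f·[u⊕v]≡false rewrite ·-distribˡ-⊕ f u v | f·u≡true | f·v≡true = refl

  sends : u ⊕ (f · u) ∙ (u ⊕ v) ≡ v
  sends rewrite f·u≡true = ⊕-cancelˡ u v

  fixes : ∀ {z} → f · z ≡ false → z ⊕ (f · z) ∙ (u ⊕ v) ≡ z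
  fixes {z} f·z≡false rewrite f·z≡false = ⊕-identityʳ z

e₁ : ∀ {n} → Z2^ (suc n)
e₁ = true ∷ 𝟎

e₂ : ∀ {n} → Z2^ (suc (suc n))
e₂ = false ∷ e₁

nonzero⇒dual : ∀ {n} {x : Z2^ n} → x ≢ 𝟎 → ∃ λ f → f · x ≡ true
nonzero⇒dual {x = []}        []≢𝟎 = ⊥-elim ([]≢𝟎 refl)
nonzero⇒dual {x = true ∷ x}  _    = e₁ , cong (true xor_) (·-zeroˡ x)
nonzero⇒dual {x = false ∷ x} x≢𝟎  with f , f·x≡true ← nonzero⇒dual (x≢𝟎 ∘ cong (false ∷_)) =
  false ∷ f , f·x≡true

dual-through-e₁ : ∀ {n} {a : Z2^ (suc n)} → a ≢ 𝟎 → ∃ λ f → f · a ≡ true × f · e₁ ≡ true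
dual-through-e₁ {n} {true ∷ a} _  = e₁ , cong (true xor_) (·-zeroˡ a) , cong (true xor_) (·-zeroˡ (𝟎 {n}))
dual-through-e₁ {n} {false ∷ a} a≢𝟎 with g , g·a≡true ← nonzero⇒dual (a≢𝟎 ∘ cong (false ∷_)) =
  true ∷ g , g·a≡true , cong (true xor_) (·-zeroʳ g)

tail≢𝟎 : ∀ {n b} {c : Z2^ (suc n)} → b ∷ c ≢ 𝟎 → b ∷ c ≢ e₁ → c ≢ 𝟎
tail≢𝟎 {b = true}  _   ≢e₁ = ≢e₁ ∘ cong (true ∷_)
tail≢𝟎 {b = false} ≢𝟎  _   = ≢𝟎 ∘ cong (false ∷_)

dual-through-e₂ : ∀ {n} {c : Z2^ (suc (suc n))} → c ≢ 𝟎 → c ≢ e₁ →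
  ∃ λ g → g · e₁ ≡ false × g · c ≡ true × g · e₂ ≡ true
dual-through-e₂ {c = _ ∷ _} c≢𝟎 c≢e₁ with h , h·c≡true , h·e₁≡true ← dual-through-e₁ (tail≢𝟎 c≢𝟎 c≢e₁) =
  false ∷ h , ·-zeroʳ h , h·c≡true , h·e₁≡true

normalise : ∀ {n} {a c : Z2^ (suc (suc n))} → a ≢ 𝟎 → c ≢ 𝟎 → a ≢ c →
  Σ (LinearInjection (suc (suc n))) λ φ → apply φ a ≡ e₁ × apply φ c ≡ e₂
normalise {a = a} {c} a≢𝟎 c≢𝟎 a≢c
  with f , f·a≡true , f·e₁≡true ← dual-through-e₁ a≢𝟎
  with τ , τa≡e₁ , _ ← transvection-sends f f·a≡true f·e₁≡true
  with g , g·e₁≡false , g·τc≡true , g·e₂≡true ←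
         dual-through-e₂ (apply-nonzero τ c≢𝟎) (λ τc≡e₁ → a≢c (apply-injective τ (trans τa≡e₁ (sym τc≡e₁))))
  with σ , στc≡e₂ , σ-fixes ← transvection-sends g g·τc≡true g·e₂≡true =
  σ ∘ᴸ τ , trans (cong (apply σ) τa≡e₁) (σ-fixes g·e₁≡false) , στc≡e₂

record Admissible {n} (N : ℕ) (W : ℕ → Z2^ n) : Set where
  field
    injective : ∀ {i j} → i < N → j < N → W i ≡ W j → i ≡ j
    nonzero   : ∀ {i} → i < N → W i ≢ 𝟎
    middle    : ∀ k → suc (suc (2 * k)) < N → W (suc (2 * k)) ≡ W (2 * k) ⊕ W (suc (suc (2 * k)))

admissible-∘ : ∀ {n N} {W : ℕ → Z2^ n} (φ : LinearInjection n) → Admissible N W → Admissible N (apply φ ∘ W)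
admissible-∘ φ adm = record
  { injective = λ i<N j<N φWi≡φWj → injective i<N j<N (apply-injective φ φWi≡φWj)
  ; nonzero   = λ i<N → apply-nonzero φ (nonzero i<N)
  ; middle    = λ k bound → trans (cong (apply φ) (middle k bound)) (apply-⊕ φ _ _)
  }
  where open Admissible adm

extend : ∀ {n N} → (Fin N → Z2^ n) → ℕ → Z2^ n
extend {N = N} v i with i <? N
... | yes i<N = v (fromℕ< i<N)
... | no  _   = 𝟎

extend-< : ∀ {n N} (v : Fin N → Z2^ n) {i} (i<N : i < N) → extend v i ≡ v (fromℕ< i<N)
extend-< {N = N} v {i} i<N with i <? N
... | yes _    = refl
... | no  i≮N  = contradiction i<N i≮N

permutation⇒admissible : ∀ {n} {v : Fin (2 ^ n ∸ 1) → Z2^ n} →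
  IsPermutationOfF n v → TripleCondition n v → Admissible (2 ^ n ∸ 1) (extend v)
permutation⇒admissible {n} {v} (v-injective , v-nonzero , _) triple = record
  { injective = injective
  ; nonzero   = λ i<N vi≡𝟎 → v-nonzero (fromℕ< i<N) (trans (sym (extend-< v i<N)) vi≡𝟎)
  ; middle    = middle
  }
  where
  open ≡-Reasoning

  injective : ∀ {i j} → i < 2 ^ n ∸ 1 → j < 2 ^ n ∸ 1 → extend v i ≡ extend v j → i ≡ j
  injective {i} {j} i<N j<N vi≡vj = begin
    i                   ≡⟨ toℕ-fromℕ< i<N ⟨
    toℕ (fromℕ< i<N)    ≡⟨ cong toℕ (v-injective (trans (sym (extend-< v i<N)) (trans vi≡vj (extend-< v j<N)))) ⟩
    toℕ (fromℕ< j<N)    ≡⟨ toℕ-fromℕ< j<N ⟩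
    j                   ∎

  middle : ∀ k → suc (suc (2 * k)) < 2 ^ n ∸ 1 →
    extend v (suc (2 * k)) ≡ extend v (2 * k) ⊕ extend v (suc (suc (2 * k)))
  middle k c<N = begin
    extend v (suc (2 * k))                               ≡⟨ extend-< v b<N ⟩
    v (fromℕ< b<N)                                       ≡⟨ zero-sum⇒middle (triple k _ _ _ a≡ b≡ c≡) ⟩
    v (fromℕ< a<N) ⊕ v (fromℕ< c<N)                      ≡⟨ cong₂ _⊕_ (extend-< v a<N) (extend-< v c<N) ⟨
    extend v (2 * k) ⊕ extend v (suc (suc (2 * k)))      ∎
    where
    b<N = <-trans (n<1+n _) c<N
    a<N = <-trans (n<1+n _) b<N
    a≡ = toℕ-fromℕ< a<N
    b≡ = trans (toℕ-fromℕ< b<N) (+-comm 1 (2 * k))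
    c≡ = trans (toℕ-fromℕ< c<N) (+-comm 2 (2 * k))

data Extension {n} (last : Z2^ n) (used : List (Z2^ n)) : ℕ → Set where
  stop : Extension last used zero
  next : ∀ {d} mid x → mid ≡ last ⊕ x → mid ∉ used → x ∉ mid ∷ used →
         Extension x (x ∷ mid ∷ used) d → Extension last used (suc d)

-- 𝟎 is listed as used from the start, so "unused" also means "nonzero".
visited : ∀ {n} → (ℕ → Z2^ n) → ℕ → List (Z2^ n)
visited W zero    = 𝟎 ∷ []
visited W (suc m) = W m ∷ visited W m

∉-∷ : ∀ {A : Set} {x y : A} {ys} → x ≢ y → x ∉ ys → x ∉ y ∷ ys
∉-∷ x≢y _    (here x≡y)   = x≢y x≡y
∉-∷ _   x∉ys (there x∈ys) = x∉ys x∈ys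

2+2*j<1+2*[j+1+d] : ∀ j d → suc (suc (2 * j)) < suc (2 * (j + suc d))
2+2*j<1+2*[j+1+d] j d = s≤s (begin
  suc (suc (2 * j))  ≡⟨ *-suc 2 j ⟨
  2 * suc j          ≤⟨ *-monoʳ-≤ 2 (m<m+n j (s≤s z≤n)) ⟩
  2 * (j + suc d)    ∎)
  where open ≤-Reasoning

module _ {n N} {W : ℕ → Z2^ n} (adm : Admissible N W) where
  open Admissible adm

  visited-fresh : ∀ {m k} → m < N → k ≤ m → W m ∉ visited W k
  visited-fresh m<N z≤n = ∉-∷ (nonzero m<N) λ ()
  visited-fresh {k = suc k} m<N k<m =
    ∉-∷ (λ Wm≡Wk → <⇒≢ k<m (sym (injective m<N (<-trans k<m m<N) Wm≡Wk)))
        (visited-fresh m<N (<⇒≤ k<m))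

  extension : ∀ d j → N ≡ suc (2 * (j + d)) → Extension (W (2 * j)) (visited W (suc (2 * j))) d
  extension zero    j _   = stop
  extension (suc d) j N≡ =
    next _ _ (middle j c<N) (visited-fresh b<N ≤-refl) (visited-fresh c<N ≤-refl) rest
    where
    c<N : suc (suc (2 * j)) < N
    c<N = subst (_ <_) (sym N≡) (2+2*j<1+2*[j+1+d] j d)
    b<N = <-trans (n<1+n _) c<N

    rest : Extension (W (suc (suc (2 * j)))) (visited W (suc (suc (suc (2 * j))))) d
    rest = subst (λ i → Extension (W i) (visited W (suc i)) d) (*-suc 2 j)
                 (extension d (suc j) (trans N≡ (cong (λ m → suc (2 * m)) (+-suc j d))))

T-does-∧-does-∧ : ∀ {A B : Set} {c} (a? : Dec A) (b? : Dec B) → A → B → T c → T (does a? ∧ does b? ∧ c)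
T-does-∧-does-∧ (yes _) (yes _) _ _ c = c
T-does-∧-does-∧ (no ¬a) _       a _ _ = contradiction a ¬a
T-does-∧-does-∧ (yes _) (no ¬b) _ b _ = contradiction b ¬b

vectors : ∀ n → List (Z2^ n)
vectors zero    = [] ∷ []
vectors (suc n) = map (true ∷_) (vectors n) ++ map (false ∷_) (vectors n)

∈-vectors : ∀ {n} (x : Z2^ n) → x ∈ vectors n
∈-vectors []          = here refl
∈-vectors (true ∷ x)  = ∈-++⁺ˡ (∈-map⁺ (true ∷_) (∈-vectors x))
∈-vectors (false ∷ x) = ∈-++⁺ʳ _ (∈-map⁺ (false ∷_) (∈-vectors x))

module _ {n : ℕ} where
  open DecMembership (≡-dec {n = n} _≟ᵇ_) using (_∉?_)

  extendable : ℕ → Z2^ n → List (Z2^ n) → Bool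
  fresh-continuation : ℕ → Z2^ n → List (Z2^ n) → Z2^ n → Bool

  extendable zero    last used = true
  extendable (suc d) last used = any (fresh-continuation d last used) (vectors n)

  fresh-continuation d last used x =
    does (last ⊕ x ∉? used) ∧ does (x ∉? last ⊕ x ∷ used) ∧ extendable d x (x ∷ last ⊕ x ∷ used)

  fresh-continuation-complete : ∀ {d last used x} → last ⊕ x ∉ used → x ∉ last ⊕ x ∷ used →
    T (extendable d x (x ∷ last ⊕ x ∷ used)) → T (fresh-continuation d last used x)
  fresh-continuation-complete {last = last} {used} {x} =
    T-does-∧-does-∧ (last ⊕ x ∉? used) (x ∉? last ⊕ x ∷ used)

  extendable-complete : ∀ {d last used} → Extension last used d → T (extendable d last used)
  extendable-complete stop = _
  extendable-complete {suc d} {last} {used} (next _ x refl mid∉used x∉used rest) =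
    any⁺ (fresh-continuation d last used)
         (lose (∈-vectors x) (fresh-continuation-complete {d} mid∉used x∉used (extendable-complete rest)))

opening : ∀ {n} → Z2^ n → Z2^ n → List (Z2^ n)
opening a c = c ∷ a ⊕ c ∷ a ∷ 𝟎 ∷ []

opening-extendable : ∀ {n} d {W : ℕ → Z2^ n} →
  Admissible (suc (2 * suc d)) W → T (extendable d (W 2) (opening (W 0) (W 2)))
opening-extendable d {W} adm =
  extendable-complete (subst (λ b → Extension (W 2) (W 2 ∷ b ∷ W 0 ∷ 𝟎 ∷ []) d)
                             (Admissible.middle adm 0 (2+2*j<1+2*[j+1+d] 0 d))
                             (extension adm d 1 refl))

admissible⇒extendable : ∀ {n} d {W : ℕ → Z2^ (suc (suc n))} →
  Admissible (suc (2 * suc d)) W → T (extendable d e₂ (opening e₁ e₂))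
admissible⇒extendable d {W} adm =
  let (φ , φW₀≡e₁ , φW₂≡e₂) = normalise (nonzero 0<N) (nonzero 2<N) W₀≢W₂
  in subst₂ (λ a c → T (extendable d c (opening a c))) φW₀≡e₁ φW₂≡e₂
            (opening-extendable d (admissible-∘ φ adm))
  where
  open Admissible adm
  0<N : 0 < suc (2 * suc d)
  0<N = s≤s z≤n
  2<N : 2 < suc (2 * suc d)
  2<N = 2+2*j<1+2*[j+1+d] 0 d
  W₀≢W₂ : W 0 ≢ W 2
  W₀≢W₂ W₀≡W₂ with () ← injective 0<N 2<N W₀≡W₂

no-admissible : ∀ {n} d → extendable d e₂ (opening e₁ e₂) ≡ false →
  ∀ {W : ℕ → Z2^ (suc (suc n))} → ¬ Admissible (suc (2 * suc d)) W
no-admissible d search-fails adm = subst T search-fails (admissible⇒extendable d adm)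

proposition2 : (∀ (v : Fin (2 ^ 3 ∸ 1) → Z2^ 3) → ¬ (IsPermutationOfF 3 v × TripleCondition 3 v))
    × (∀ (v : Fin (2 ^ 4 ∸ 1) → Z2^ 4) → ¬ (IsPermutationOfF 4 v × TripleCondition 4 v))
proposition2 =
  (λ v (permutation , triple) → no-admissible 2 refl (permutation⇒admissible permutation triple)) ,
  (λ v (permutation , triple) → no-admissible 6 refl (permutation⇒admissible permutation triple))
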